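{- Let $a,b$ be two distinct constants of a finite alphabet $A$ and let $x,y$ be variables. Then the length abstraction of the word equation $xaby=yabx$ is exactly the set of pairs $(n_x,n_y)\in\mathbb{N}^2$ satisfying $$n_x=n_y\ \vee\ (n_x=0\wedge n_y\equiv 0 \pmod 2)\ \vee\ (n_y=0\wedge n_x\equiv 0\pmod 2)\ \vee\ (n_x>0\wedge n_y>0\wedge \gcd(n_x+2,n_y+2)>1).$$
   Context: A solution of a word equation $L=R$ over constants $A$ and variables $V$ (with $A\cap V=\emptyset$) is a monoid homomorphism $\sigma:(A\cup V)^*\to A^*$ fixing each letter of $A$ with $\sigma(L)=\sigma(R)$. The length abstraction of the equation $xaby=yabx$ (variables $x,y$) is the set $\{(|\sigma(x)|,|\sigma(y)|):\sigma \text{ a solution}\}$. -}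

module Defs where

open import Data.Nat using (ℕ; _+_; _>_; _%_)
open import Data.Nat.GCD using (gcd)
open import Data.Fin using (Fin)
open import Data.List using (List; []; _∷_; _++_; [_]; concatMap; length)
open import Data.Sum using (_⊎_; inj₁; inj₂)
open import Data.Product using (_×_; _,_; ∃-syntax)
open import Relation.Binary.PropositionalEquality using (_≡_)

data Var : Set where
  x y : Var

Term : Set → Set
Term A = List (A ⊎ Var)

subst : {A : Set} → (Var → List A) → Term A → List A
subst σ [] = []
subst σ (inj₁ c ∷ w) = c ∷ subst σ w
subst σ (inj₂ v ∷ w) = σ v ++ subst σ w

IsSolution : {A : Set} → (Var → List A) → Term A → Term A → Set
IsSolution σ L R = subst σ L ≡ subst σ R

lhs rhs : {A : Set} → A → A → Term A
lhs a b = inj₂ x ∷ inj₁ a ∷ inj₁ b ∷ inj₂ y ∷ []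
rhs a b = inj₂ y ∷ inj₁ a ∷ inj₁ b ∷ inj₂ x ∷ []

InLengthAbstraction : {A : Set} → Term A → Term A → ℕ → ℕ → Set
InLengthAbstraction {A} L R n m =
  ∃[ σ ] (IsSolution {A} σ L R × length (σ x) ≡ n × length (σ y) ≡ m)

LengthCondition : ℕ → ℕ → Set
LengthCondition nx ny =
  (nx ≡ ny)
  ⊎ ((nx ≡ 0 × ny % 2 ≡ 0)
  ⊎ ((ny ≡ 0 × nx % 2 ≡ 0)
  ⊎ (nx > 0 × ny > 0 × gcd (nx + 2) (ny + 2) > 1)))

module Submission where

-- Write w = ab.  An assignment σ solves the equation iff the two words
-- u = σ(x) w and v = σ(y) w commute (append w on the right, or cancel it).
-- By the Lyndon–Schützenberger theorem, two words commute iff both are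
-- powers of a common word z, which we prove by Euclid-style peeling of the
-- shorter word.  Since u ends in the two distinct letters a b, z has
-- length at least 2, so |z| is a common divisor ≥ 2 of |σ(x)| + 2 and
-- |σ(y)| + 2.  Conversely, for any d = e + 2 dividing nx + 2 and ny + 2,
-- take z = aᵉ a b; prefixes X, Y of powers of z with X w, Y w powers of z
-- and |X| = nx, |Y| = ny give a solution.  Hence the length abstraction is
-- the set of pairs whose shifted lengths have a common divisor ≥ 2, and a
-- purely arithmetic case analysis identifies this with the paper's
-- condition.

open import Defs
open import Data.Nat using (ℕ; zero; suc; _+_; _*_; _≤_; _<_; z≤n; s≤s; _%_)
open import Data.Nat.Properties
open import Data.Nat.Divisibility
  using (_∣_; divides; ∣⇒≤; ∣-refl; ∣m∣n⇒∣m+n; ∣m+n∣m⇒∣n; m%n≡0⇒n∣m; n∣m⇒m%n≡0)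
open import Data.Nat.GCD using (gcd; gcd[m,n]∣m; gcd[m,n]∣n; gcd-greatest; gcd[m,n]≢0)
open import Data.Nat.Base using (≢-nonZero)
open import Data.Fin using (Fin)
open import Data.List using (List; []; _∷_; _++_; length; replicate)
open import Data.List.Properties
  using (++-assoc; ++-identityʳ; length-++; ++-cancelˡ; ++-cancelʳ; ++-conicalʳ; ∷-injective; length-replicate)
open import Data.Sum using (inj₁; inj₂)
open import Data.Product using (_×_; _,_; proj₂; ∃-syntax)
open import Data.Empty using (⊥-elim)
open import Function.Bundles using (_⇔_; mk⇔; Equivalence)
open import Relation.Binary.PropositionalEquality
  using (_≡_; _≢_; refl; sym; trans; cong; cong₂; module ≡-Reasoning)
  renaming (subst to transport)
open import Relation.Nullary using (¬_; yes; no)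

module Words {A : Set} where

  power : List A → ℕ → List A
  power z zero    = []
  power z (suc i) = z ++ power z i

  power-+ : ∀ z i j → power z i ++ power z j ≡ power z (i + j)
  power-+ z zero    j = refl
  power-+ z (suc i) j = trans (++-assoc z (power z i) (power z j)) (cong (z ++_) (power-+ z i j))

  power-snoc : ∀ z i → power z i ++ z ≡ power z (suc i)
  power-snoc z zero    = sym (++-identityʳ z)
  power-snoc z (suc i) = trans (++-assoc z (power z i) z) (cong (z ++_) (power-snoc z i))

  length-power : ∀ z i → length (power z i) ≡ i * length z
  length-power z zero    = refl
  length-power z (suc i) = trans (length-++ z) (cong (length z +_) (length-power z i))

  power-[] : ∀ i → power [] i ≡ []
  power-[] zero    = refl
  power-[] (suc i) = power-[] i

  prefix : ∀ (u v s t : List A) → length u ≤ length v → u ++ s ≡ v ++ t → ∃[ w ] v ≡ u ++ w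
  prefix []      v       s t _         _  = v , refl
  prefix (c ∷ u) (d ∷ v) s t (s≤s u≤v) eq with ∷-injective eq
  ... | refl , eq′ with prefix u v s t u≤v eq′
  ...   | w , refl = w , refl

  CommonRoot : List A → List A → Set
  CommonRoot u v = ∃[ z ] ∃[ i ] ∃[ j ] (u ≡ power z i × v ≡ power z j)

  commonRoot-swap : ∀ {u v} → CommonRoot u v → CommonRoot v u
  commonRoot-swap (z , i , j , u≡zⁱ , v≡zʲ) = z , j , i , v≡zʲ , u≡zⁱ

  commonRoot-grow : ∀ {u w} → CommonRoot u w → CommonRoot u (u ++ w)
  commonRoot-grow (z , i , j , refl , refl) = z , i , i + j , refl , power-+ z i j

  peel : ∀ u v → u ++ v ≡ v ++ u → length u ≤ length v →
         ∃[ w ] (v ≡ u ++ w × u ++ w ≡ w ++ u)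
  peel u v eq u≤v with prefix u v v u u≤v eq
  ... | w , refl = w , refl , ++-cancelˡ u (u ++ w) (w ++ u) (trans eq (++-assoc u w u))

  peel-shrinks : ∀ n (c : A) u w → length (c ∷ u) + length (c ∷ u ++ w) ≤ suc n →
                 length (c ∷ u) + length w ≤ n
  peel-shrinks n c u w bound = ≤-pred (<-≤-trans (+-monoʳ-< (length (c ∷ u)) (s≤s w≤uw)) bound)
    where
    w≤uw : length w ≤ length (u ++ w)
    w≤uw = ≤-trans (m≤n+m (length w) (length u)) (≤-reflexive (sym (length-++ u)))

  commute⇒commonRoot′ : ∀ n u v → length u + length v ≤ n → u ++ v ≡ v ++ u → CommonRoot u v
  commute⇒commonRoot′ n       []      v       _     _  = v , 0 , 1 , refl , sym (++-identityʳ v)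
  commute⇒commonRoot′ n       (c ∷ u) []      _     _  = c ∷ u , 1 , 0 , sym (++-identityʳ (c ∷ u)) , refl
  commute⇒commonRoot′ zero    (c ∷ u) (d ∷ v) ()    _
  commute⇒commonRoot′ (suc n) (c ∷ u) (d ∷ v) bound eq with length (c ∷ u) ≤? length (d ∷ v)
  ... | yes u≤v with peel (c ∷ u) (d ∷ v) eq u≤v
  ...   | w , refl , eq′ =
    commonRoot-grow (commute⇒commonRoot′ n (c ∷ u) w (peel-shrinks n c u w bound) eq′)
  commute⇒commonRoot′ (suc n) (c ∷ u) (d ∷ v) bound eq | no u≰v
    with peel (d ∷ v) (c ∷ u) (sym eq) (<⇒≤ (≰⇒> u≰v))
  ... | w , refl , eq′ =
    commonRoot-swap (commonRoot-grow (commute⇒commonRoot′ n (d ∷ v) w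
      (peel-shrinks n d v w (≤-trans (≤-reflexive (+-comm (length (d ∷ v)) _)) bound)) eq′))

  commute⇒commonRoot : ∀ u v → u ++ v ≡ v ++ u → CommonRoot u v
  commute⇒commonRoot u v = commute⇒commonRoot′ _ u v ≤-refl

  commonRoot⇒commute : ∀ {u v} → CommonRoot u v → u ++ v ≡ v ++ u
  commonRoot⇒commute (z , i , j , refl , refl) =
    trans (power-+ z i j) (trans (cong (power z) (+-comm i j)) (sym (power-+ z j i)))

  conjugate⇔commute : ∀ (X Y w : List A) →
    (X ++ w ++ Y ≡ Y ++ w ++ X) ⇔ ((X ++ w) ++ (Y ++ w) ≡ (Y ++ w) ++ (X ++ w))
  conjugate⇔commute X Y w = mk⇔
    (λ eq → trans (reassoc X Y) (trans (cong (_++ w) eq) (sym (reassoc Y X))))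
    (λ eq → ++-cancelʳ w _ _ (trans (sym (reassoc X Y)) (trans eq (reassoc Y X))))
    where
    reassoc : ∀ X Y → (X ++ w) ++ (Y ++ w) ≡ (X ++ w ++ Y) ++ w
    reassoc X Y = begin
      (X ++ w) ++ (Y ++ w) ≡⟨ ++-assoc X w (Y ++ w) ⟩
      X ++ w ++ Y ++ w     ≡⟨ cong (X ++_) (sym (++-assoc w Y w)) ⟩
      X ++ (w ++ Y) ++ w   ≡⟨ sym (++-assoc X (w ++ Y) w) ⟩
      (X ++ w ++ Y) ++ w   ∎
      where open ≡-Reasoning

  ends-distinct : ∀ (a b c : A) xs i → xs ++ a ∷ b ∷ [] ≡ power (c ∷ []) i → a ≡ b
  ends-distinct a b c []           (suc (suc i)) eq with ∷-injective eq
  ... | refl , eq′ with ∷-injective eq′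
  ...   | refl , _ = refl
  ends-distinct a b c (_ ∷ xs)     (suc i)       eq = ends-distinct a b c xs i (proj₂ (∷-injective eq))
  ends-distinct a b c []           (suc zero)    ()
  ends-distinct a b c []           zero          ()
  ends-distinct a b c (_ ∷ _)      zero          ()

  root-length≥2 : ∀ (a b : A) → a ≢ b → ∀ X z i → X ++ a ∷ b ∷ [] ≡ power z i → 2 ≤ length z
  root-length≥2 a b a≢b X []          i eq with ++-conicalʳ X (a ∷ b ∷ []) (trans eq (power-[] i))
  ... | ()
  root-length≥2 a b a≢b X (c ∷ [])    i eq = ⊥-elim (a≢b (ends-distinct a b c X i eq))
  root-length≥2 a b a≢b X (_ ∷ _ ∷ _) i eq = s≤s (s≤s z≤n)

  -- If |p w| divides n + |w| (and w is non-empty), some X of length n has X w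
  -- a power of p w, namely X = (p w)ⁱ p.
  power-prefix : ∀ (p w : List A) n → 0 < length w → length (p ++ w) ∣ n + length w →
                 ∃[ X ] ∃[ q ] (X ++ w ≡ power (p ++ w) q × length X ≡ n)
  power-prefix p w n w≢[] (divides zero eq) =
    ⊥-elim (<-irrefl (sym (m+n≡0⇒n≡0 n eq)) w≢[])
  power-prefix p w n w≢[] (divides (suc i) eq) =
    power z i ++ p , suc i , X++w≡zⁱ⁺¹ , +-cancelʳ-≡ (length w) _ n lengths
    where
    open ≡-Reasoning
    z = p ++ w
    X++w≡zⁱ⁺¹ : (power z i ++ p) ++ w ≡ power z (suc i)
    X++w≡zⁱ⁺¹ = trans (++-assoc (power z i) p w) (power-snoc z i)
    lengths : length (power z i ++ p) + length w ≡ n + length w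
    lengths = begin
      length (power z i ++ p) + length w        ≡⟨ cong (_+ length w) (length-++ (power z i)) ⟩
      length (power z i) + length p + length w  ≡⟨ +-assoc (length (power z i)) _ _ ⟩
      length (power z i) + (length p + length w) ≡⟨ +-comm (length (power z i)) _ ⟩
      (length p + length w) + length (power z i) ≡⟨ cong₂ _+_ (sym (length-++ p)) (length-power z i) ⟩
      suc i * length z                           ≡⟨ sym eq ⟩
      n + length w                               ∎

open Words

CommonDivisor : ℕ → ℕ → Set
CommonDivisor nx ny = ∃[ d ] (2 ≤ d × d ∣ nx + 2 × d ∣ ny + 2)

-- A common divisor ≥ 2 of 2 and m + 2 is 2 itself, so m is even.
even-shift : ∀ d m → 2 ≤ d → d ∣ 2 → d ∣ m + 2 → m % 2 ≡ 0
even-shift d m 2≤d d∣2 d∣m+2 with ≤-antisym (∣⇒≤ d∣2) 2≤d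
... | refl = n∣m⇒m%n≡0 m 2 (∣m+n∣m⇒∣n (transport (2 ∣_) (+-comm m 2) d∣m+2) ∣-refl)

-- The paper's condition is exactly the existence of such a common divisor:
-- if nx = 0 the divisor must be 2, forcing ny even (and symmetrically);
-- if both are positive the divisor bounds the gcd from below.
commonDivisor⇒condition : ∀ nx ny → CommonDivisor nx ny → LengthCondition nx ny
commonDivisor⇒condition zero    zero    _                    = inj₁ refl
commonDivisor⇒condition zero    (suc m) (d , 2≤d , d∣2 , d∣) = inj₂ (inj₁ (refl , even-shift d (suc m) 2≤d d∣2 d∣))
commonDivisor⇒condition (suc m) zero    (d , 2≤d , d∣ , d∣2) = inj₂ (inj₂ (inj₁ (refl , even-shift d (suc m) 2≤d d∣2 d∣)))
commonDivisor⇒condition (suc m) (suc k) (d , 2≤d , d∣x , d∣y) =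
  inj₂ (inj₂ (inj₂ (s≤s z≤n , s≤s z≤n , ≤-trans 2≤d (∣⇒≤ ⦃ gcd-nonZero ⦄ (gcd-greatest d∣x d∣y)))))
  where
  gcd-nonZero = ≢-nonZero (gcd[m,n]≢0 (suc m + 2) (suc k + 2) (inj₁ λ ()))

condition⇒commonDivisor : ∀ nx ny → LengthCondition nx ny → CommonDivisor nx ny
condition⇒commonDivisor nx .nx (inj₁ refl) = nx + 2 , m≤n+m 2 nx , ∣-refl , ∣-refl
condition⇒commonDivisor .0 ny (inj₂ (inj₁ (refl , even))) =
  2 , ≤-refl , ∣-refl , ∣m∣n⇒∣m+n (m%n≡0⇒n∣m ny 2 even) ∣-refl
condition⇒commonDivisor nx .0 (inj₂ (inj₂ (inj₁ (refl , even)))) =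
  2 , ≤-refl , ∣m∣n⇒∣m+n (m%n≡0⇒n∣m nx 2 even) ∣-refl , ∣-refl
condition⇒commonDivisor nx ny (inj₂ (inj₂ (inj₂ (_ , _ , 1<gcd)))) =
  gcd (nx + 2) (ny + 2) , 1<gcd , gcd[m,n]∣m (nx + 2) (ny + 2) , gcd[m,n]∣n (nx + 2) (ny + 2)

module Equation {A : Set} (a b : A) where

  ab : List A
  ab = a ∷ b ∷ []

  solution⇔commute : ∀ σ → IsSolution σ (lhs a b) (rhs a b) ⇔
    ((σ x ++ ab) ++ (σ y ++ ab) ≡ (σ y ++ ab) ++ (σ x ++ ab))
  solution⇔commute σ
    rewrite ++-identityʳ (σ x) | ++-identityʳ (σ y) = conjugate⇔commute (σ x) (σ y) ab

  root-divides : ∀ X z i → X ++ ab ≡ power z i → length z ∣ length X + 2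
  root-divides X z i eq = divides i (trans (sym (length-++ X)) (trans (cong length eq) (length-power z i)))

  solution⇒commonDivisor : a ≢ b → ∀ σ → IsSolution σ (lhs a b) (rhs a b) →
                           CommonDivisor (length (σ x)) (length (σ y))
  solution⇒commonDivisor a≢b σ sol
    with commute⇒commonRoot (σ x ++ ab) (σ y ++ ab) (Equivalence.to (solution⇔commute σ) sol)
  ... | z , i , j , eqx , eqy =
    length z , root-length≥2 a b a≢b (σ x) z i eqx , root-divides (σ x) z i eqx , root-divides (σ y) z j eqy

  -- With d = e + 2 a common divisor, powers of the root aᵉ a b realise (nx, ny).
  commonDivisor⇒solution : ∀ nx ny → CommonDivisor nx ny →
                           InLengthAbstraction (lhs a b) (rhs a b) nx ny
  commonDivisor⇒solution nx ny (suc (suc e) , s≤s (s≤s z≤n) , d∣x , d∣y)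
    with power-prefix p ab nx (s≤s z≤n) (d∣′ d∣x) | power-prefix p ab ny (s≤s z≤n) (d∣′ d∣y)
    where
    p : List A
    p = replicate e a
    -- |aᵉ a b| = e + 2
    d∣′ : ∀ {n} → suc (suc e) ∣ n → length (p ++ ab) ∣ n
    d∣′ = transport (_∣ _)
            (sym (trans (length-++ p) (trans (cong (_+ 2) (length-replicate e)) (+-comm e 2))))
  ... | X , i , eqx , refl | Y , j , eqy , refl =
    σ , Equivalence.from (solution⇔commute σ) (commonRoot⇒commute (_ , i , j , eqx , eqy)) , refl , refl
    where
    σ : Var → List A
    σ x = X
    σ y = Y

open Equation

lemma1 : (k : ℕ) (a b : Fin k) → ¬ (a ≡ b) → (nx ny : ℕ) →
    (InLengthAbstraction (lhs a b) (rhs a b) nx ny ⇔ LengthCondition nx ny)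
lemma1 k a b a≢b nx ny = mk⇔ sound complete
  where
  sound : InLengthAbstraction (lhs a b) (rhs a b) nx ny → LengthCondition nx ny
  sound (σ , sol , refl , refl) = commonDivisor⇒condition nx ny (solution⇒commonDivisor a b a≢b σ sol)
  complete : LengthCondition nx ny → InLengthAbstraction (lhs a b) (rhs a b) nx ny
  complete cond = commonDivisor⇒solution a b nx ny (condition⇒commonDivisor nx ny cond)
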